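{- Let $G$ be a graph with two subgraphs $G_X,G_Y$ such that $G=G_X\cup G_Y$ and such that for every connected component $U$ of $G_X$ (viewed as a vertex set), the graph $G_X[U]\cap G_Y$ is connected. If $\mathcal{B}_X,\mathcal{B}_Y$ are cycle bases of $G_X$ and $G_Y$ respectively, then $\mathcal{B}_X\cup\mathcal{B}_Y$ generates the cycle space of $G$. In particular $\mathrm{bn}(G)\le\mathrm{bn}(G_X)+\mathrm{bn}(G_Y)$.
   Context: All graphs are finite and simple. Union and intersection of subgraphs are taken on vertex sets and edge sets. Subsets of $E(G)$ form an $\mathbb{F}_2$-vector space under symmetric difference; an $\mathbb{F}_2$-cycle is a subgraph with all degrees even; these form the cycle space, a cycle basis is a basis of it. The congestion of a family of subgraphs is the maximum over edges $e$ of the number of members containing $e$; $\mathrm{bn}(G)$ is the minimum congestion of a cycle basis of $G$. -}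

module Defs where

open import Data.Bool using (Bool; true; false; _∧_; _∨_; _xor_; if_then_else_)
open import Data.Nat using (ℕ; _+_; _⊔_; _≤_)
open import Data.Nat.Divisibility using (_∣_)
open import Data.Fin using (Fin; splitAt)
open import Data.List using (List; foldr; map; allFin)
open import Data.Nat.ListAction using (sum)
open import Data.Sum using ([_,_])
open import Data.Product using (Σ; ∃; _×_)
open import Relation.Binary.PropositionalEquality using (_≡_)

-- Vertices are drawn from the ambient finite set Fin n.
-- An edge set is a Bool-valued function on ordered pairs, read symmetrically
-- (the unordered edge {u,v} is present iff E u v ≡ true).
EdgeSet : ℕ → Set
EdgeSet n = Fin n → Fin n → Bool

VertexSet : ℕ → Set
VertexSet n = Fin n → Bool

record Graph (n : ℕ) : Set where
  field
    V      : VertexSet n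
    E      : EdgeSet n
    sym    : ∀ u v → E u v ≡ E v u
    irrefl : ∀ u → E u u ≡ false
    ends   : ∀ u v → E u v ≡ true → V u ≡ true
open Graph public

_⊆G_ : ∀ {n} → Graph n → Graph n → Set
H ⊆G G = (∀ v → V H v ≡ true → V G v ≡ true)
       × (∀ u v → E H u v ≡ true → E G u v ≡ true)

IsUnion : ∀ {n} → Graph n → Graph n → Graph n → Set
IsUnion G GX GY = (∀ v → V G v ≡ (V GX v ∨ V GY v))
                × (∀ u v → E G u v ≡ (E GX u v ∨ E GY u v))

data Walk {n} (H : Graph n) : Fin n → Fin n → Set where
  here : ∀ {u} → V H u ≡ true → Walk H u u
  step : ∀ {u w v} → E H u w ≡ true → Walk H w v → Walk H u v

Connected : ∀ {n} → Graph n → Set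
Connected H = (∃ λ v → V H v ≡ true)
            × (∀ u v → V H u ≡ true → V H v ≡ true → Walk H u v)

IsComponent : ∀ {n} → Graph n → VertexSet n → Set
IsComponent H U = ∃ λ v → V H v ≡ true
  × (∀ w → (U w ≡ true → Walk H v w) × (Walk H v w → U w ≡ true))

InducedCap : ∀ {n} → Graph n → VertexSet n → Graph n → Graph n
InducedCap {n} H U K = record
  { V = λ v → (V H v ∧ U v) ∧ V K v
  ; E = λ u v → ((E H u v ∧ (U u ∧ U v)) ∧ E K u v)
  ; sym = symP
  ; irrefl = irr
  ; ends = endsP }
  where
  open import Data.Bool.Properties using (∧-comm)
  open import Relation.Binary.PropositionalEquality using (cong₂; refl; trans; sym)
  symP : ∀ u v → ((E H u v ∧ (U u ∧ U v)) ∧ E K u v) ≡ ((E H v u ∧ (U v ∧ U u)) ∧ E K v u)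
  symP u v = cong₂ _∧_ (cong₂ _∧_ (Graph.sym H u v) (∧-comm (U u) (U v))) (Graph.sym K u v)
  irr : ∀ u → ((E H u u ∧ (U u ∧ U u)) ∧ E K u u) ≡ false
  irr u rewrite Graph.irrefl H u = refl
  endsP : ∀ u v → ((E H u v ∧ (U u ∧ U v)) ∧ E K u v) ≡ true → ((V H u ∧ U u) ∧ V K u) ≡ true
  endsP u v p with E H u v in eH | U u | U v | E K u v in eK
  ... | true | true | true | true
      rewrite Graph.ends H u v eH | Graph.ends K u v eK = refl

deg : ∀ {n} → EdgeSet n → Fin n → ℕ
deg {n} C v = sum (map (λ w → if C v w then 1 else 0) (allFin n))

IsCycle : ∀ {n} → Graph n → EdgeSet n → Set
IsCycle H C = (∀ u v → C u v ≡ C v u)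
            × (∀ u v → C u v ≡ true → E H u v ≡ true)
            × (∀ v → 2 ∣ deg C v)

Family : ℕ → ℕ → Set
Family n k = Fin k → EdgeSet n

subsetSum : ∀ {n k} → (Fin k → Bool) → Family n k → EdgeSet n
subsetSum {n} {k} S B u v = foldr _xor_ false (map (λ i → S i ∧ B i u v) (allFin k))

_≈E_ : ∀ {n} → EdgeSet n → EdgeSet n → Set
C ≈E D = ∀ u v → C u v ≡ D u v

_⊕_ : ∀ {n} → EdgeSet n → EdgeSet n → EdgeSet n
(C ⊕ D) u v = C u v xor D u v

emptyE : ∀ {n} → EdgeSet n
emptyE u v = false

Generates : ∀ {n k} → Graph n → Family n k → Set
Generates {n} {k} H B = ∀ C → IsCycle H C → ∃ λ (S : Fin k → Bool) → C ≈E subsetSum S B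

LinIndep : ∀ {n k} → Family n k → Set
LinIndep {n} {k} B = ∀ (S : Fin k → Bool) → subsetSum S B ≈E emptyE → ∀ i → S i ≡ false

IsCycleBasis : ∀ {n k} → Graph n → Family n k → Set
IsCycleBasis H B = (∀ i → IsCycle H (B i)) × LinIndep B × Generates H B

_∪F_ : ∀ {n k l} → Family n k → Family n l → Family n (k + l)
_∪F_ {k = k} BX BY i = [ BX , BY ] (splitAt k i)

load : ∀ {n k} → Family n k → Fin n → Fin n → ℕ
load {k = k} B u v = sum (map (λ i → if B i u v then 1 else 0) (allFin k))

congestion : ∀ {n k} → Family n k → ℕ
congestion {n} B =
  foldr _⊔_ 0 (map (λ u → foldr _⊔_ 0 (map (λ v → load B u v) (allFin n))) (allFin n))

IsBn : ∀ {n} → Graph n → ℕ → Set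
IsBn {n} H b = (∃ λ k → Σ (Family n k) λ B → IsCycleBasis H B × congestion B ≡ b)
             × (∀ k (B : Family n k) → IsCycleBasis H B → b ≤ congestion B)

module Submission where

-- Split a cycle C of G into D = C ∩ E(GX) and R = C − E(GX) ⊆ E(GY). Since C has even degrees, D and R
-- have the same odd vertices, and these lie in GY. By the handshake lemma every component U of GX
-- contains an even number of them, so they can be paired off by walks in the connected graph
-- GX[U] ∩ GY; the F₂-sum J of these walks has exactly the odd vertices of D. Then D + J and R + J are
-- cycles of GX and GY with sum C. For the bound, sifting BX ∪ BY greedily yields a cycle basis of G
-- whose load on every edge is at most that of BX ∪ BY, i.e. the sum of the loads of BX and BY.

open import Defs hiding (sym)
open import Algebra.Bundles using (Monoid; CommutativeRing)
open import Data.Bool using (Bool; true; false; not; _∧_; _xor_; if_then_else_)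
open import Data.Bool.Properties as Bool
  using (xor-∧-commutativeRing; xor-same; xor-identityʳ; xor-assoc; ∧-identityʳ; ∧-zeroʳ)
open import Data.Empty using (⊥-elim)
open import Data.Fin as Fin using (Fin; zero; suc; splitAt; _<?_)
open import Data.Fin.Properties using (any?; all?; <-cmp; punchInᵢ≢i)
open import Data.Fin.Subset using (Subset; _∈_; _⊆_; _⊂_; _∪_; ⁅_⁆; ∣_∣)
open import Data.Fin.Subset.Properties
  using (_∈?_; anySubset?; p⊆p∪q; x∈p∪q⁺; x∈p∪q⁻; x∈⁅x⁆; x∈⁅y⁆⇒x≡y;
         p⊂q⇒∣p∣<∣q∣; ∣p∣≤n)
open import Data.List using (foldr; map; allFin; tabulate)
open import Data.List.Properties using (map-tabulate)
open import Data.Nat using (ℕ; zero; suc; _+_; _*_; _≤_; _<_; _⊔_; z≤n)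
import Data.Nat.Properties as ℕ
open import Data.Nat.Divisibility using (_∣_; divides; ∣m+n∣m⇒∣n; n∣m*n; ∣1⇒≡1)
open import Data.Product using (∃; ∃₂; _×_; _,_; proj₁; proj₂)
open import Data.Sum using (_⊎_; inj₁; inj₂)
import Data.Vec as Vec
open import Data.Vec.Properties using ([]=⇒lookup; lookup⇒[]=; lookup∘tabulate)
import Data.Vec.Functional as Vector
open Vector using (Vector; _++_; _∷_; tail)
open import Function using (_∘_; _⇔_; mk⇔; Equivalence)
open import Relation.Binary using (tri<; tri≈; tri>)
open import Relation.Binary.PropositionalEquality
  using (_≡_; _≢_; refl; sym; trans; cong; cong₂; subst; subst₂; _≗_; module ≡-Reasoning)
open import Relation.Nullary using (¬_; ¬?; Dec; yes; no; does; _×-dec_)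
open import Relation.Nullary.Decidable using (dec-true; dec-false)

open CommutativeRing xor-∧-commutativeRing using (semiring)
open import Algebra.Properties.Semiring.Sum semiring
  using (∑-distrib-+; ∑-comm; *-distribˡ-sum; sum-cong-≗; sum-remove; sum-replicate-zero)
  renaming (sum to ⨁)
open import Algebra.Properties.Monoid.Sum ℕ.+-0-monoid
  using () renaming (sum to ∑; sum-cong-≗ to ∑-cong-≗)

private
  variable
    A B : Set
    n k l m : ℕ

-- Finite sums

foldr-tabulate : (_∙_ : A → B → B) (e : B) (f : Fin n → A) →
                 foldr _∙_ e (tabulate f) ≡ Vector.foldr _∙_ e f
foldr-tabulate {n = zero}  _∙_ e f = refl
foldr-tabulate {n = suc n} _∙_ e f = cong (f zero ∙_) (foldr-tabulate _∙_ e (f ∘ suc))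

foldr-map-allFin : (_∙_ : A → B → B) (e : B) (f : Fin n → A) →
                   foldr _∙_ e (map f (allFin n)) ≡ Vector.foldr _∙_ e f
foldr-map-allFin {n = n} _∙_ e f =
  trans (cong (foldr _∙_ e) (map-tabulate {n = n} (λ i → i) f)) (foldr-tabulate _∙_ e f)

tail-++ : ∀ {a} {A : Set a} (f : Vector A (suc k)) (g : Vector A l) → tail (f ++ g) ≗ tail f ++ g
tail-++ {k = k} f g i with splitAt k i
... | inj₁ _ = refl
... | inj₂ _ = refl

map-++ : (h : A → B) (f : Vector A k) (g : Vector A l) →
         Vector.map h (f ++ g) ≗ Vector.map h f ++ Vector.map h g
map-++ {k = k} h f g i with splitAt k i
... | inj₁ _ = refl
... | inj₂ _ = refl

zipWith-++ : ∀ {C : Set} (h : A → B → C) (f : Vector A k) (g : Vector A l) (f′ : Vector B k) (g′ : Vector B l) →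
             Vector.zipWith h (f ++ g) (f′ ++ g′) ≗ Vector.zipWith h f f′ ++ Vector.zipWith h g g′
zipWith-++ {k = k} h f g f′ g′ i with splitAt k i
... | inj₁ _ = refl
... | inj₂ _ = refl

module _ {c ℓ} (M : Monoid c ℓ) where
  open Monoid M using (Carrier; _≈_; _∙_; ∙-congˡ; identityˡ; assoc)
    renaming (sym to ≈-sym; trans to ≈-trans; reflexive to ≈-reflexive)
  open import Algebra.Properties.Monoid.Sum M using (sum) renaming (sum-cong-≗ to sum-cong)

  sum-++ : (f : Vector Carrier k) (g : Vector Carrier l) → sum (f ++ g) ≈ sum f ∙ sum g
  sum-++ {zero}  f g = ≈-sym (identityˡ _)
  sum-++ {suc k} f g =
    ≈-trans (∙-congˡ (≈-trans (≈-reflexive (sum-cong (tail-++ f g))) (sum-++ (tail f) g))) (≈-sym (assoc _ _ _))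

⨁-concentrated : (g : Vector Bool n) (t : Fin n) → (∀ s → s ≢ t → g s ≡ false) → ⨁ g ≡ g t
⨁-concentrated {suc n} g t elsewhere = begin
  ⨁ g                                   ≡⟨ sum-remove g ⟩
  g t xor ⨁ (Vector.removeAt g t)       ≡⟨ cong (g t xor_) (sum-cong-≗ (elsewhere _ ∘ punchInᵢ≢i t)) ⟩
  g t xor ⨁ (Vector.replicate n false)  ≡⟨ cong (g t xor_) (sum-replicate-zero n) ⟩
  g t xor false                         ≡⟨ xor-identityʳ (g t) ⟩
  g t                                   ∎
  where open ≡-Reasoning

⨁≡true⇒∃ : (g : Vector Bool n) → ⨁ g ≡ true → ∃ λ i → g i ≡ true
⨁≡true⇒∃ {suc n} g p with g zero in g₀
... | true  = zero , g₀
... | false = let i , gi = ⨁≡true⇒∃ (g ∘ suc) p in suc i , gi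

⨁≡false⇒partner : (g : Vector Bool n) {t : Fin n} → ⨁ g ≡ false → g t ≡ true →
                  ∃ λ s → s ≢ t × g s ≡ true
⨁≡false⇒partner g {t} even gt with any? (λ s → ¬? (s Fin.≟ t) ×-dec (g s Bool.≟ true))
... | yes partner = partner
... | no  none    = ⊥-elim (Bool.not-¬ gt (trans (sym (⨁-concentrated g t alone)) even))
  where
  alone : ∀ s → s ≢ t → g s ≡ false
  alone s s≢t = Bool.¬-not (λ gs → none (s , s≢t , gs))

-- f is its strict upper triangle plus the transpose of that, and ∑-comm gives both halves the same sum.
handshake : (f : Fin n → Fin n → Bool) → (∀ v w → f v w ≡ f w v) → (∀ v → f v v ≡ false) →
            ⨁ (λ v → ⨁ (f v)) ≡ false
handshake {n} f f-sym f-diag = begin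
  ⨁ (λ v → ⨁ (f v))
    ≡⟨ sum-cong-≗ (λ v → trans (sum-cong-≗ (split v)) (∑-distrib-+ (upper v) (λ w → upper w v))) ⟩
  ⨁ (λ v → ⨁ (upper v) xor ⨁ (λ w → upper w v))
    ≡⟨ ∑-distrib-+ (λ v → ⨁ (upper v)) (λ v → ⨁ (λ w → upper w v)) ⟩
  ⨁ (λ v → ⨁ (upper v)) xor ⨁ (λ v → ⨁ (λ w → upper w v))
    ≡⟨ cong (⨁ (λ v → ⨁ (upper v)) xor_) (∑-comm (λ v w → upper w v)) ⟩
  ⨁ (λ v → ⨁ (upper v)) xor ⨁ (λ w → ⨁ (upper w))
    ≡⟨ xor-same (⨁ (λ v → ⨁ (upper v))) ⟩
  false ∎
  where
  open ≡-Reasoning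
  upper : Fin n → Fin n → Bool
  upper v w = f v w ∧ does (v <? w)
  split : ∀ v w → f v w ≡ upper v w xor upper w v
  split v w with <-cmp v w
  ... | tri< v<w _ w≮v rewrite dec-true (v <? w) v<w | dec-false (w <? v) w≮v
      | ∧-identityʳ (f v w) | ∧-zeroʳ (f w v) = sym (xor-identityʳ (f v w))
  ... | tri≈ _ refl _ = trans (f-diag v) (sym (xor-same (upper v v)))
  ... | tri> v≮w _ w<v rewrite dec-false (v <? w) v≮w | dec-true (w <? v) w<v
      | ∧-identityʳ (f w v) | ∧-zeroʳ (f v w) = f-sym v w

count : Vector Bool n → ℕ
count f = ∑ (λ i → if f i then 1 else 0)

count-parity : (f : Vector Bool n) → ∃ λ q → count f ≡ (if ⨁ f then 1 else 0) + q * 2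
count-parity {zero}  f = 0 , refl
count-parity {suc n} f with count-parity (f ∘ suc)
... | q , eq rewrite eq with f zero | ⨁ (f ∘ suc)
...   | false | _     = q , refl
...   | true  | false = q , refl
...   | true  | true  = suc q , refl

2∣count⇔⨁≡false : (f : Vector Bool n) → 2 ∣ count f ⇔ ⨁ f ≡ false
2∣count⇔⨁≡false f with ⨁ f | count-parity f
... | false | q , eq = mk⇔ (λ _ → refl) (λ _ → divides q eq)
... | true  | q , eq = mk⇔ (⊥-elim ∘ 2∤1+q*2) (λ ())
  where
  2∤1+q*2 : ¬ 2 ∣ count f
  2∤1+q*2 2∣ with ∣1⇒≡1 (∣m+n∣m⇒∣n (subst (2 ∣_) (trans eq (ℕ.+-comm 1 (q * 2))) 2∣) (n∣m*n q))
  ... | ()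

xor≡false⇒≡ : ∀ {a b} → a xor b ≡ false → a ≡ b
xor≡false⇒≡ {true}  {true}  _ = refl
xor≡false⇒≡ {false} {false} _ = refl

xor-cancel-common : ∀ a b c → (a xor c) xor (b xor c) ≡ a xor b
xor-cancel-common true  true  c = xor-same (not c)
xor-cancel-common true  false c = Bool.xor-inverseˡ c
xor-cancel-common false true  c = Bool.xor-inverseʳ c
xor-cancel-common false false c = xor-same c

-- Linear combinations of edge sets

_∈span_ : EdgeSet n → Family n k → Set
C ∈span B = ∃ λ S → C ≈E subsetSum S B

subsetSum-⨁ : (S : Vector Bool k) (B : Family n k) → ∀ u v → subsetSum S B u v ≡ ⨁ (λ i → S i ∧ B i u v)
subsetSum-⨁ S B u v = foldr-map-allFin _xor_ false (λ i → S i ∧ B i u v)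

subsetSum-suc : (S : Vector Bool (suc k)) (B : Family n (suc k)) → ∀ u v →
                subsetSum S B u v ≡ (S zero ∧ B zero u v) xor subsetSum (S ∘ suc) (B ∘ suc) u v
subsetSum-suc S B u v =
  trans (subsetSum-⨁ S B u v) (cong ((S zero ∧ B zero u v) xor_) (sym (subsetSum-⨁ (S ∘ suc) (B ∘ suc) u v)))

subsetSum-cong : {S S′ : Vector Bool k} → S ≗ S′ → (B : Family n k) → ∀ u v →
                 subsetSum S B u v ≡ subsetSum S′ B u v
subsetSum-cong {S = S} {S′} S≗S′ B u v = begin
  subsetSum S B u v         ≡⟨ subsetSum-⨁ S B u v ⟩
  ⨁ (λ i → S i ∧ B i u v)   ≡⟨ sum-cong-≗ (λ i → cong (_∧ B i u v) (S≗S′ i)) ⟩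
  ⨁ (λ i → S′ i ∧ B i u v)  ≡⟨ subsetSum-⨁ S′ B u v ⟨
  subsetSum S′ B u v        ∎
  where open ≡-Reasoning

subsetSum-linear : (a : Bool) (S S′ : Vector Bool k) (B : Family n k) → ∀ u v →
  (a ∧ subsetSum S B u v) xor subsetSum S′ B u v ≡ subsetSum (λ i → (a ∧ S i) xor S′ i) B u v
subsetSum-linear a S S′ B u v = begin
  (a ∧ subsetSum S B u v) xor subsetSum S′ B u v
    ≡⟨ cong₂ (λ x y → (a ∧ x) xor y) (subsetSum-⨁ S B u v) (subsetSum-⨁ S′ B u v) ⟩
  (a ∧ ⨁ (λ i → S i ∧ B i u v)) xor ⨁ (λ i → S′ i ∧ B i u v)
    ≡⟨ cong (_xor ⨁ (λ i → S′ i ∧ B i u v)) (*-distribˡ-sum a (λ i → S i ∧ B i u v)) ⟩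
  ⨁ (λ i → a ∧ (S i ∧ B i u v)) xor ⨁ (λ i → S′ i ∧ B i u v)
    ≡⟨ ∑-distrib-+ (λ i → a ∧ (S i ∧ B i u v)) (λ i → S′ i ∧ B i u v) ⟨
  ⨁ (λ i → (a ∧ (S i ∧ B i u v)) xor (S′ i ∧ B i u v))
    ≡⟨ sum-cong-≗ (λ i → trans (cong (_xor (S′ i ∧ B i u v)) (sym (Bool.∧-assoc a (S i) (B i u v))))
                               (sym (Bool.∧-distribʳ-xor (B i u v) (a ∧ S i) (S′ i)))) ⟩
  ⨁ (λ i → ((a ∧ S i) xor S′ i) ∧ B i u v)
    ≡⟨ subsetSum-⨁ (λ i → (a ∧ S i) xor S′ i) B u v ⟨
  subsetSum (λ i → (a ∧ S i) xor S′ i) B u v ∎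
  where open ≡-Reasoning

subsetSum-++ : (SX : Vector Bool k) (SY : Vector Bool l) (BX : Family n k) (BY : Family n l) → ∀ u v →
               subsetSum (SX ++ SY) (BX ∪F BY) u v ≡ subsetSum SX BX u v xor subsetSum SY BY u v
subsetSum-++ {n = n} SX SY BX BY u v = begin
  subsetSum (SX ++ SY) (BX ∪F BY) u v
    ≡⟨ subsetSum-⨁ (SX ++ SY) (BX ∪F BY) u v ⟩
  ⨁ (Vector.zipWith select (SX ++ SY) (BX ++ BY))
    ≡⟨ sum-cong-≗ (zipWith-++ select SX SY BX BY) ⟩
  ⨁ (Vector.zipWith select SX BX ++ Vector.zipWith select SY BY)
    ≡⟨ sum-++ (CommutativeRing.+-monoid xor-∧-commutativeRing) (Vector.zipWith select SX BX) _ ⟩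
  ⨁ (Vector.zipWith select SX BX) xor ⨁ (Vector.zipWith select SY BY)
    ≡⟨ cong₂ _xor_ (subsetSum-⨁ SX BX u v) (subsetSum-⨁ SY BY u v) ⟨
  subsetSum SX BX u v xor subsetSum SY BY u v ∎
  where
  open ≡-Reasoning
  select : Bool → EdgeSet n → Bool
  select s C = s ∧ C u v

∈span? : (C : EdgeSet n) (B : Family n k) → Dec (C ∈span B)
∈span? C B with anySubset? (λ s → all? (λ u → all? (λ v → C u v Bool.≟ subsetSum (Vec.lookup s) B u v)))
... | yes (s , C≈) = yes (Vec.lookup s , C≈)
... | no  none     = no λ (S , C≈) →
  none (Vec.tabulate S , λ u v → trans (C≈ u v) (subsetSum-cong (λ i → sym (lookup∘tabulate S i)) B u v))

span-absorb : {B : Family n (suc k)} {R : Family n m} → B zero ∈span R →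
              (∀ C → C ∈span (B ∘ suc) → C ∈span R) → ∀ C → C ∈span B → C ∈span R
span-absorb {B = B} {R} (S₀ , B₀≈) tail-spans C (S , C≈)
  with tail-spans (subsetSum (S ∘ suc) (B ∘ suc)) (S ∘ suc , λ _ _ → refl)
... | S′ , tail≈ = (λ j → (S zero ∧ S₀ j) xor S′ j) , λ u v → begin
  C u v
    ≡⟨ trans (C≈ u v) (subsetSum-suc S B u v) ⟩
  (S zero ∧ B zero u v) xor subsetSum (S ∘ suc) (B ∘ suc) u v
    ≡⟨ cong₂ (λ x y → (S zero ∧ x) xor y) (B₀≈ u v) (tail≈ u v) ⟩
  (S zero ∧ subsetSum S₀ R u v) xor subsetSum S′ R u v
    ≡⟨ subsetSum-linear (S zero) S₀ S′ R u v ⟩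
  subsetSum (λ j → (S zero ∧ S₀ j) xor S′ j) R u v ∎
  where open ≡-Reasoning

span-extend : {B : Family n (suc k)} {R : Family n m} →
              (∀ C → C ∈span (B ∘ suc) → C ∈span R) → ∀ C → C ∈span B → C ∈span (B zero ∷ R)
span-extend {B = B} {R} tail-spans C (S , C≈)
  with tail-spans (subsetSum (S ∘ suc) (B ∘ suc)) (S ∘ suc , λ _ _ → refl)
... | S′ , tail≈ = S zero ∷ S′ , λ u v → begin
  C u v
    ≡⟨ trans (C≈ u v) (subsetSum-suc S B u v) ⟩
  (S zero ∧ B zero u v) xor subsetSum (S ∘ suc) (B ∘ suc) u v
    ≡⟨ cong ((S zero ∧ B zero u v) xor_) (tail≈ u v) ⟩
  (S zero ∧ B zero u v) xor subsetSum S′ R u v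
    ≡⟨ subsetSum-suc (S zero ∷ S′) (B zero ∷ R) u v ⟨
  subsetSum (S zero ∷ S′) (B zero ∷ R) u v ∎
  where open ≡-Reasoning

independent-extend : {C : EdgeSet n} {R : Family n m} → ¬ C ∈span R → LinIndep R → LinIndep (C ∷ R)
independent-extend {C = C} {R} C∉R R-indep S S≈0 = all-false
  where
  head≈tail : ∀ u v → S zero ∧ C u v ≡ subsetSum (S ∘ suc) R u v
  head≈tail u v = xor≡false⇒≡ (trans (sym (subsetSum-suc S (C ∷ R) u v)) (S≈0 u v))
  head-false : S zero ≡ false
  head-false with S zero | head≈tail
  ... | false | _  = refl
  ... | true  | C≈ = ⊥-elim (C∉R (S ∘ suc , C≈))
  all-false : ∀ i → S i ≡ false
  all-false zero    = head-false
  all-false (suc i) = R-indep (S ∘ suc) (λ u v → trans (sym (head≈tail u v)) (cong (_∧ C u v) head-false)) i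

-- Load and congestion

load-∑ : (B : Family n k) → ∀ u v → load B u v ≡ ∑ (λ i → if B i u v then 1 else 0)
load-∑ B u v = foldr-map-allFin _+_ 0 (λ i → if B i u v then 1 else 0)

load-suc : (B : Family n (suc k)) → ∀ u v → load B u v ≡ (if B zero u v then 1 else 0) + load (B ∘ suc) u v
load-suc B u v = trans (load-∑ B u v) (cong ((if B zero u v then 1 else 0) +_) (sym (load-∑ (B ∘ suc) u v)))

load-tail≤ : (B : Family n (suc k)) → ∀ u v → load (B ∘ suc) u v ≤ load B u v
load-tail≤ B u v = subst (load (B ∘ suc) u v ≤_) (sym (load-suc B u v)) (ℕ.m≤n+m _ _)

load-head∷-mono : (B : Family n (suc k)) {R : Family n m} → (∀ u v → load R u v ≤ load (B ∘ suc) u v) →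
                  ∀ u v → load (B zero ∷ R) u v ≤ load B u v
load-head∷-mono B {R} R≤ u v = begin
  load (B zero ∷ R) u v                               ≡⟨ load-suc (B zero ∷ R) u v ⟩
  (if B zero u v then 1 else 0) + load R u v          ≤⟨ ℕ.+-monoʳ-≤ _ (R≤ u v) ⟩
  (if B zero u v then 1 else 0) + load (B ∘ suc) u v  ≡⟨ load-suc B u v ⟨
  load B u v                                          ∎
  where open ℕ.≤-Reasoning

load-++ : (A : Family n k) (B : Family n l) → ∀ u v → load (A ∪F B) u v ≡ load A u v + load B u v
load-++ {n = n} A B u v = begin
  load (A ∪F B) u v                                        ≡⟨ load-∑ (A ∪F B) u v ⟩
  ∑ (Vector.map indicator (A ++ B))                        ≡⟨ ∑-cong-≗ (map-++ indicator A B) ⟩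
  ∑ (Vector.map indicator A ++ Vector.map indicator B)     ≡⟨ sum-++ ℕ.+-0-monoid (Vector.map indicator A) _ ⟩
  ∑ (Vector.map indicator A) + ∑ (Vector.map indicator B)  ≡⟨ cong₂ _+_ (load-∑ A u v) (load-∑ B u v) ⟨
  load A u v + load B u v                                  ∎
  where
  open ≡-Reasoning
  indicator : EdgeSet n → ℕ
  indicator C = if C u v then 1 else 0

≤-maximum : (f : Fin n → ℕ) (i : Fin n) → f i ≤ foldr _⊔_ 0 (map f (allFin n))
≤-maximum f i = subst (f i ≤_) (sym (foldr-map-allFin _⊔_ 0 f)) (≤-max f i)
  where
  ≤-max : (f : Vector ℕ m) (i : Fin m) → f i ≤ Vector.foldr _⊔_ 0 f
  ≤-max f zero    = ℕ.m≤m⊔n (f zero) _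
  ≤-max f (suc i) = ℕ.m≤n⇒m≤o⊔n (f zero) (≤-max (f ∘ suc) i)

maximum-lub : {c : ℕ} (f : Fin n → ℕ) → (∀ i → f i ≤ c) → foldr _⊔_ 0 (map f (allFin n)) ≤ c
maximum-lub {c = c} f f≤c = subst (_≤ c) (sym (foldr-map-allFin _⊔_ 0 f)) (max-lub f f≤c)
  where
  max-lub : (f : Vector ℕ m) → (∀ i → f i ≤ c) → Vector.foldr _⊔_ 0 f ≤ c
  max-lub {zero}  f _   = z≤n
  max-lub {suc m} f f≤c = ℕ.⊔-lub (f≤c zero) (max-lub (f ∘ suc) (f≤c ∘ suc))

load≤congestion : (B : Family n k) → ∀ u v → load B u v ≤ congestion B
load≤congestion {n} B u v =
  ℕ.≤-trans (≤-maximum (load B u) v) (≤-maximum (λ u → foldr _⊔_ 0 (map (load B u) (allFin n))) u)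

congestion-lub : {c : ℕ} (B : Family n k) → (∀ u v → load B u v ≤ c) → congestion B ≤ c
congestion-lub B load≤c = maximum-lub _ (λ u → maximum-lub (load B u) (load≤c u))

congestion-mono : (A : Family n k) (B : Family n l) → (∀ u v → load A u v ≤ load B u v) →
                  congestion A ≤ congestion B
congestion-mono A B load≤ = congestion-lub A (λ u v → ℕ.≤-trans (load≤ u v) (load≤congestion B u v))

congestion-∪F : (A : Family n k) (B : Family n l) → congestion (A ∪F B) ≤ congestion A + congestion B
congestion-∪F A B = congestion-lub (A ∪F B) λ u v →
  subst (_≤ _) (sym (load-++ A B u v)) (ℕ.+-mono-≤ (load≤congestion A u v) (load≤congestion B u v))

basis-subfamily : (B : Family n k) → ∃₂ λ m (R : Family n m) →
  (∀ j → ∃ λ i → R j ≡ B i) × LinIndep R × (∀ C → C ∈span B → C ∈span R) ×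
  (∀ u v → load R u v ≤ load B u v)
basis-subfamily {k = zero}  B = 0 , B , (λ ()) , (λ _ _ ()) , (λ _ C∈B → C∈B) , (λ _ _ → ℕ.≤-refl)
basis-subfamily {k = suc k} B with basis-subfamily (B ∘ suc)
... | m , R , R⊆B , R-indep , R-spans , R≤ with ∈span? (B zero) R
...   | yes B₀∈R = m , R , (λ j → suc (proj₁ (R⊆B j)) , proj₂ (R⊆B j)) , R-indep ,
                   span-absorb B₀∈R R-spans , λ u v → ℕ.≤-trans (R≤ u v) (load-tail≤ B u v)
...   | no  B₀∉R = suc m , B zero ∷ R , members , independent-extend B₀∉R R-indep , span-extend R-spans ,
                   load-head∷-mono B {R} R≤
  where
  members : ∀ j → ∃ λ i → (B zero ∷ R) j ≡ B i
  members zero    = zero , refl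
  members (suc j) = suc (proj₁ (R⊆B j)) , proj₂ (R⊆B j)

-- Degrees and cycles

Symmetric : EdgeSet n → Set
Symmetric C = ∀ u v → C u v ≡ C v u

_⊆E_ : EdgeSet n → Graph n → Set
C ⊆E H = ∀ u v → C u v ≡ true → E H u v ≡ true

odd : EdgeSet n → VertexSet n
odd C v = ⨁ (C v)

⊕-symmetric : {C D : EdgeSet n} → Symmetric C → Symmetric D → Symmetric (C ⊕ D)
⊕-symmetric C-sym D-sym u v = cong₂ _xor_ (C-sym u v) (D-sym u v)

⊕-⊆E : {C D : EdgeSet n} {H : Graph n} → C ⊆E H → D ⊆E H → (C ⊕ D) ⊆E H
⊕-⊆E {C = C} C⊆H D⊆H u v p with C u v in c
... | true  = C⊆H u v c
... | false = D⊆H u v p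

odd-⊕ : (C D : EdgeSet n) → ∀ v → odd (C ⊕ D) v ≡ odd C v xor odd D v
odd-⊕ C D v = ∑-distrib-+ (C v) (D v)

odd-emptyE : ∀ v → odd {n} emptyE v ≡ false
odd-emptyE {n} v = sum-replicate-zero n

odd⇒vertex : {C : EdgeSet n} {H : Graph n} → C ⊆E H → ∀ {v} → odd C v ≡ true → V H v ≡ true
odd⇒vertex {C = C} {H} C⊆H {v} p = let w , vw = ⨁≡true⇒∃ (C v) p in ends H v w (C⊆H v w vw)

2∣deg⇔even : (C : EdgeSet n) → ∀ v → 2 ∣ deg C v ⇔ odd C v ≡ false
2∣deg⇔even C v = subst (λ d → 2 ∣ d ⇔ odd C v ≡ false)
                       (sym (foldr-map-allFin _+_ 0 (λ w → if C v w then 1 else 0))) (2∣count⇔⨁≡false (C v))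

cycle⇒even : {H : Graph n} {C : EdgeSet n} → IsCycle H C → ∀ v → odd C v ≡ false
cycle⇒even {C = C} (_ , _ , even-deg) v = Equivalence.to (2∣deg⇔even C v) (even-deg v)

even⇒cycle : {H : Graph n} {C : EdgeSet n} → Symmetric C → C ⊆E H → (∀ v → odd C v ≡ false) → IsCycle H C
even⇒cycle {C = C} C-sym C⊆H even = C-sym , C⊆H , λ v → Equivalence.from (2∣deg⇔even C v) (even v)

cycle-mono : {H G : Graph n} {C : EdgeSet n} → H ⊆G G → IsCycle H C → IsCycle G C
cycle-mono (_ , E⊆) (C-sym , C⊆H , even-deg) = C-sym , (λ u v → E⊆ u v ∘ C⊆H u v) , even-deg

∪F-cycles : {G GX GY : Graph n} {BX : Family n k} {BY : Family n l} → GX ⊆G G → GY ⊆G G →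
            (∀ i → IsCycle GX (BX i)) → (∀ i → IsCycle GY (BY i)) → ∀ i → IsCycle G ((BX ∪F BY) i)
∪F-cycles {k = k} {G = G} {GX} {GY} {BX} {BY} GX⊆G GY⊆G BX-cycles BY-cycles i with splitAt k i
... | inj₁ j = cycle-mono {H = GX} {G} {BX j} GX⊆G (BX-cycles j)
... | inj₂ j = cycle-mono {H = GY} {G} {BY j} GY⊆G (BY-cycles j)

cycle-basis-within : {H : Graph n} (B : Family n k) → (∀ i → IsCycle H (B i)) → Generates H B →
                     ∃₂ λ m (R : Family n m) → IsCycleBasis H R × congestion R ≤ congestion B
cycle-basis-within {H = H} B B-cycles B-generates with basis-subfamily B
... | m , R , R⊆B , R-indep , R-spans , R≤ =
  m , R , (R-cycles , R-indep , λ C C-cycle → R-spans C (B-generates C C-cycle)) , congestion-mono R B R≤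
  where
  R-cycles : ∀ j → IsCycle H (R j)
  R-cycles j = subst (IsCycle H) (sym (proj₂ (R⊆B j))) (B-cycles (proj₁ (R⊆B j)))

-- Walks and components

point : Fin n → VertexSet n
point t v = does (v Fin.≟ t)

point-true : {t v : Fin n} → point t v ≡ true → v ≡ t
point-true {t = t} {v} p with v Fin.≟ t
... | yes v≡t = v≡t

⨁-point : (t : Fin n) → ⨁ (point t) ≡ true
⨁-point t = trans (⨁-concentrated (point t) t (λ s → dec-false (s Fin.≟ t))) (dec-true (t Fin.≟ t) refl)

-- Written with xor rather than ∨, so that odd-edge needs no hypothesis u ≢ w (edge u u is empty).
edge : Fin n → Fin n → EdgeSet n
edge u w x y = (point u x ∧ point w y) xor (point w x ∧ point u y)

edge-symmetric : (u w : Fin n) → Symmetric (edge u w)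
edge-symmetric u w x y = trans (Bool.xor-comm (point u x ∧ point w y) _)
                               (cong₂ _xor_ (Bool.∧-comm (point w x) _) (Bool.∧-comm (point u x) _))

∧-xor-∧≡true : ∀ a b c d → (a ∧ b) xor (c ∧ d) ≡ true →
               (a ≡ true × b ≡ true) ⊎ (c ≡ true × d ≡ true)
∧-xor-∧≡true true  true  _     _     _  = inj₁ (refl , refl)
∧-xor-∧≡true true  false true  true  _  = inj₂ (refl , refl)
∧-xor-∧≡true false _     true  true  _  = inj₂ (refl , refl)
∧-xor-∧≡true true  false true  false ()
∧-xor-∧≡true true  false false _     ()
∧-xor-∧≡true false _     true  false ()
∧-xor-∧≡true false _     false _     ()

edge-⊆E : {H : Graph n} {u w : Fin n} → E H u w ≡ true → edge u w ⊆E H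
edge-⊆E {H = H} {u} {w} uw x y p with ∧-xor-∧≡true (point u x) (point w y) (point w x) (point u y) p
... | inj₁ (x≡u , y≡w) = subst₂ (λ a b → E H a b ≡ true) (sym (point-true x≡u)) (sym (point-true y≡w)) uw
... | inj₂ (x≡w , y≡u) =
  subst₂ (λ a b → E H a b ≡ true) (sym (point-true x≡w)) (sym (point-true y≡u)) (trans (Graph.sym H w u) uw)

odd-edge : (u w : Fin n) → ∀ v → odd (edge u w) v ≡ point u v xor point w v
odd-edge u w v = begin
  ⨁ (λ y → (point u v ∧ point w y) xor (point w v ∧ point u y))
    ≡⟨ ∑-distrib-+ (λ y → point u v ∧ point w y) (λ y → point w v ∧ point u y) ⟩
  ⨁ (λ y → point u v ∧ point w y) xor ⨁ (λ y → point w v ∧ point u y)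
    ≡⟨ cong₂ _xor_ (*-distribˡ-sum (point u v) (point w)) (*-distribˡ-sum (point w v) (point u)) ⟨
  (point u v ∧ ⨁ (point w)) xor (point w v ∧ ⨁ (point u))
    ≡⟨ cong₂ (λ a b → (point u v ∧ a) xor (point w v ∧ b)) (⨁-point w) (⨁-point u) ⟩
  (point u v ∧ true) xor (point w v ∧ true)
    ≡⟨ cong₂ _xor_ (∧-identityʳ (point u v)) (∧-identityʳ (point w v)) ⟩
  point u v xor point w v ∎
  where open ≡-Reasoning

module _ {H : Graph n} where

  walkEdges : {a b : Fin n} → Walk H a b → EdgeSet n
  walkEdges (here _)           = emptyE
  walkEdges (step {u} {w} _ W) = edge u w ⊕ walkEdges W

  walkEdges-symmetric : {a b : Fin n} (W : Walk H a b) → Symmetric (walkEdges W)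
  walkEdges-symmetric (here _)           u v = refl
  walkEdges-symmetric (step {u} {w} _ W)     = ⊕-symmetric (edge-symmetric u w) (walkEdges-symmetric W)

  walkEdges-⊆E : {a b : Fin n} (W : Walk H a b) → walkEdges W ⊆E H
  walkEdges-⊆E (here _)   u v ()
  walkEdges-⊆E (step e W)     = ⊕-⊆E {H = H} (edge-⊆E {H = H} e) (walkEdges-⊆E W)

  odd-walkEdges : {a b : Fin n} (W : Walk H a b) → ∀ v → odd (walkEdges W) v ≡ point a v xor point b v
  odd-walkEdges {a} (here _) v = trans (odd-emptyE v) (sym (xor-same (point a v)))
  odd-walkEdges (step {u} {w} {b} _ W) v = begin
    odd (edge u w ⊕ walkEdges W) v
      ≡⟨ trans (odd-⊕ (edge u w) (walkEdges W) v) (cong₂ _xor_ (odd-edge u w v) (odd-walkEdges W v)) ⟩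
    (point u v xor point w v) xor (point w v xor point b v)
      ≡⟨ xor-assoc (point u v) _ _ ⟩
    point u v xor (point w v xor (point w v xor point b v))
      ≡⟨ cong (point u v xor_) (sym (xor-assoc (point w v) _ _)) ⟩
    point u v xor ((point w v xor point w v) xor point b v)
      ≡⟨ cong (λ x → point u v xor (x xor point b v)) (xor-same (point w v)) ⟩
    point u v xor point b v ∎
    where open ≡-Reasoning

  snoc : {a b c : Fin n} → Walk H a b → E H b c ≡ true → Walk H a c
  snoc {c = c} (here _) bc = step bc (here (ends H c _ (trans (Graph.sym H c _) bc)))
  snoc (step e W)       bc = step e (snoc W bc)

  component-edge : {U : VertexSet n} → IsComponent H U → ∀ {u w} → U u ≡ true → E H u w ≡ true → U w ≡ true
  component-edge (_ , _ , U⇔walk) {u} {w} Uu uw = proj₂ (U⇔walk w) (snoc (proj₁ (U⇔walk u) Uu) uw)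

  component-edge-≡ : {U : VertexSet n} → IsComponent H U → ∀ {u w} → E H u w ≡ true → U u ≡ U w
  component-edge-≡ comp {u} {w} uw = Bool.⇔→≡ (mk⇔ (λ Uu → component-edge comp Uu uw)
                                                  (λ Uw → component-edge comp Uw (trans (Graph.sym H w u) uw)))

  EdgeClosed : Subset n → Set
  EdgeClosed S = ∀ {u w} → u ∈ S → E H u w ≡ true → w ∈ S

  ReachableFrom : Fin n → Subset n → Set
  ReachableFrom t S = ∀ {w} → w ∈ S → Walk H t w

  -- k is fuel: every step adds a vertex to S, so n ≤ k + ∣ S ∣ leaves enough of it.
  edge-closure : ∀ k (S : Subset n) {t} → n ≤ k + ∣ S ∣ → ReachableFrom t S →
                 ∃ λ T → S ⊆ T × EdgeClosed T × ReachableFrom t T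
  edge-closure k S bound reach
    with any? (λ u → any? (λ w → u ∈? S ×-dec E H u w Bool.≟ true ×-dec ¬? (w ∈? S)))
  ... | no none = S , (λ x∈S → x∈S) , closed , reach
    where
    closed : EdgeClosed S
    closed {u} {w} u∈S uw with w ∈? S
    ... | yes w∈S = w∈S
    ... | no  w∉S = ⊥-elim (none (u , w , u∈S , uw , w∉S))
  ... | yes (u , w , u∈S , uw , w∉S) = continue k bound
    where
    S′ : Subset n
    S′ = S ∪ ⁅ w ⁆
    grows : ∣ S ∣ < ∣ S′ ∣
    grows = p⊂q⇒∣p∣<∣q∣ (p⊆p∪q ⁅ w ⁆ , w , x∈p∪q⁺ (inj₂ (x∈⁅x⁆ w)) , w∉S)
    reach′ : ReachableFrom _ S′
    reach′ x∈S′ with x∈p∪q⁻ S ⁅ w ⁆ x∈S′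
    ... | inj₁ x∈S = reach x∈S
    ... | inj₂ x∈w with x∈⁅y⁆⇒x≡y w x∈w
    ...   | refl = snoc (reach u∈S) uw
    continue : ∀ k → n ≤ k + ∣ S ∣ → ∃ λ T → S ⊆ T × EdgeClosed T × ReachableFrom _ T
    continue zero    bound = ⊥-elim (ℕ.<⇒≱ grows (ℕ.≤-trans (∣p∣≤n S′) bound))
    continue (suc k) bound with edge-closure k S′ bound′ reach′
      where
      bound′ : n ≤ k + ∣ S′ ∣
      bound′ = begin
        n               ≤⟨ bound ⟩
        suc k + ∣ S ∣   ≡⟨ ℕ.+-suc k ∣ S ∣ ⟨
        k + suc ∣ S ∣   ≤⟨ ℕ.+-monoʳ-≤ k grows ⟩
        k + ∣ S′ ∣      ∎
        where open ℕ.≤-Reasoning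
    ... | T , S′⊆T , closed , reachT = T , (λ x∈S → S′⊆T (p⊆p∪q ⁅ w ⁆ x∈S)) , closed , reachT

  walk-closed : {S : Subset n} → EdgeClosed S → ∀ {a b} → a ∈ S → Walk H a b → b ∈ S
  walk-closed closed a∈S (here _)   = a∈S
  walk-closed closed a∈S (step e W) = walk-closed closed (closed a∈S e) W

  reachable-⁅⁆ : ∀ {t} → V H t ≡ true → ReachableFrom t ⁅ t ⁆
  reachable-⁅⁆ {t} vt w∈t with x∈⁅y⁆⇒x≡y t w∈t
  ... | refl = here vt

  component-of : ∀ {t} → V H t ≡ true → ∃ λ U → IsComponent H U × U t ≡ true
  component-of {t} vt with edge-closure n ⁅ t ⁆ (ℕ.m≤m+n n _) (reachable-⁅⁆ vt)
  ... | T , ⁅t⁆⊆T , closed , reach =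
    Vec.lookup T , (t , vt , λ w → reach ∘ lookup⇒[]= w T , []=⇒lookup ∘ walk-closed closed t∈T) ,
    []=⇒lookup t∈T
    where
    t∈T : t ∈ T
    t∈T = ⁅t⁆⊆T (x∈⁅x⁆ t)

-- Joins inside GX ∩ GY

toSubset : VertexSet n → Subset n
toSubset = Vec.tabulate

∈-toSubset⁺ : {T : VertexSet n} {x : Fin n} → T x ≡ true → x ∈ toSubset T
∈-toSubset⁺ {T = T} {x} Tx = lookup⇒[]= x (toSubset T) (trans (lookup∘tabulate T x) Tx)

∈-toSubset⁻ : {T : VertexSet n} {x : Fin n} → x ∈ toSubset T → T x ≡ true
∈-toSubset⁻ {T = T} {x} x∈T = trans (sym (lookup∘tabulate T x)) ([]=⇒lookup x∈T)

cancel-pair-⊂ : {T T′ : VertexSet n} {s t : Fin n} → s ≢ t → T t ≡ true → T s ≡ true →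
                (∀ v → T′ v ≡ T v xor (point t v xor point s v)) → toSubset T′ ⊂ toSubset T
cancel-pair-⊂ {T = T} {T′} {s} {t} s≢t Tt Ts T′≗ =
  ∈-toSubset⁺ ∘ T′⊆T ∘ ∈-toSubset⁻ , t , ∈-toSubset⁺ Tt ,
  λ t∈T′ → Bool.not-¬ (∈-toSubset⁻ t∈T′) (trans (T′≗ t) T′t)
  where
  T′⊆T : ∀ {v} → T′ v ≡ true → T v ≡ true
  T′⊆T {v} T′v with v Fin.≟ t | v Fin.≟ s | T′≗ v
  ... | yes refl | _        | _  = Tt
  ... | no _     | yes refl | _  = Ts
  ... | no _     | no _     | eq = trans (sym (trans eq (xor-identityʳ (T v)))) T′v
  T′t : T t xor (point t t xor point s t) ≡ false
  T′t rewrite Tt | dec-true (t Fin.≟ t) refl | dec-false (t Fin.≟ s) (s≢t ∘ sym) = refl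

Shared : Graph n → Graph n → EdgeSet n → Set
Shared GX GY J = Symmetric J × J ⊆E GX × J ⊆E GY

⊕-shared : {GX GY : Graph n} {J K : EdgeSet n} → Shared GX GY J → Shared GX GY K → Shared GX GY (J ⊕ K)
⊕-shared {GX = GX} {GY} (J-sym , J⊆X , J⊆Y) (K-sym , K⊆X , K⊆Y) =
  ⊕-symmetric J-sym K-sym , ⊕-⊆E {H = GX} J⊆X K⊆X , ⊕-⊆E {H = GY} J⊆Y K⊆Y

component-even : {H : Graph n} {U : VertexSet n} {D : EdgeSet n} → IsComponent H U → Symmetric D → D ⊆E H →
                 ⨁ (λ v → U v ∧ odd D v) ≡ false
component-even {H = H} {U} {D} comp D-sym D⊆H =
  trans (sum-cong-≗ (λ v → *-distribˡ-sum (U v) (D v))) (handshake (λ v w → U v ∧ D v w) sym′ diag)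
  where
  sym′ : ∀ v w → U v ∧ D v w ≡ U w ∧ D w v
  sym′ v w rewrite D-sym v w with D w v in wv
  ... | false = trans (∧-zeroʳ (U v)) (sym (∧-zeroʳ (U w)))
  ... | true  = cong (_∧ true) (sym (component-edge-≡ comp (D⊆H w v wv)))
  diag : ∀ v → U v ∧ D v v ≡ false
  diag v with D v v in vv
  ... | false = ∧-zeroʳ (U v)
  ... | true  = ⊥-elim (Bool.not-¬ (Graph.irrefl H v) (D⊆H v v vv))

module _ {GX GY : Graph n} (components-meet : ∀ U → IsComponent GX U → Connected (InducedCap GX U GY)) where

  shared-path-to-partner : {D : EdgeSet n} → Symmetric D → D ⊆E GX → (∀ {v} → odd D v ≡ true → V GY v ≡ true) →
    ∀ {t} → odd D t ≡ true →
    ∃ λ s → s ≢ t × odd D s ≡ true ×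
            ∃ λ P → Shared GX GY P × (∀ v → odd P v ≡ point t v xor point s v)
  shared-path-to-partner {D} D-sym D⊆GX odd⇒GY {t} odd-t
    with component-of {H = GX} (odd⇒vertex {H = GX} D⊆GX odd-t)
  ... | U , comp , Ut
    with ⨁≡false⇒partner (λ v → U v ∧ odd D v) (component-even comp D-sym D⊆GX) (cong₂ _∧_ Ut odd-t)
  ...   | s , s≢t , Us∧odd-s = s , s≢t , odd-s , walkEdges W , shared , odd-walkEdges W
    where
    odd-s : odd D s ≡ true
    odd-s = Bool.∧-conicalʳ (U s) _ Us∧odd-s
    in-cap : ∀ {v} → U v ≡ true → odd D v ≡ true → V (InducedCap GX U GY) v ≡ true
    in-cap {v} Uv odd-v rewrite odd⇒vertex {H = GX} D⊆GX odd-v | Uv | odd⇒GY odd-v = refl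
    W : Walk (InducedCap GX U GY) t s
    W = proj₂ (components-meet U comp) t s (in-cap Ut odd-t) (in-cap (Bool.∧-conicalˡ (U s) _ Us∧odd-s) odd-s)
    shared : Shared GX GY (walkEdges W)
    shared = walkEdges-symmetric W
           , (λ u v uv → Bool.∧-conicalˡ (E GX u v) _ (Bool.∧-conicalˡ _ _ (walkEdges-⊆E W u v uv)))
           , (λ u v uv → Bool.∧-conicalʳ _ (E GY u v) (walkEdges-⊆E W u v uv))

  shared-join : ∀ k {D : EdgeSet n} → Symmetric D → D ⊆E GX → (∀ {v} → odd D v ≡ true → V GY v ≡ true) →
                ∣ toSubset (odd D) ∣ ≤ k → ∃ λ J → Shared GX GY J × (∀ v → odd J v ≡ odd D v)
  shared-join k {D} D-sym D⊆GX odd⇒GY size with any? (λ t → odd D t Bool.≟ true)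
  ... | no none = emptyE , ((λ _ _ → refl) , (λ _ _ ()) , (λ _ _ ())) , λ v →
        trans (odd-emptyE v) (sym (Bool.¬-not (λ odd-v → none (v , odd-v))))
  ... | yes (t , odd-t) with shared-path-to-partner D-sym D⊆GX odd⇒GY odd-t
  ...   | s , s≢t , odd-s , P , P-shared@(P-sym , P⊆GX , _) , odd-P = continue k size
    where
    shrinks : toSubset (odd (D ⊕ P)) ⊂ toSubset (odd D)
    shrinks = cancel-pair-⊂ s≢t odd-t odd-s (λ v → trans (odd-⊕ D P v) (cong (odd D v xor_) (odd-P v)))
    continue : ∀ k → ∣ toSubset (odd D) ∣ ≤ k → ∃ λ J → Shared GX GY J × (∀ v → odd J v ≡ odd D v)
    continue zero    size = ⊥-elim (ℕ.n≮0 (ℕ.≤-trans (p⊂q⇒∣p∣<∣q∣ shrinks) size))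
    continue (suc k) size with shared-join k (⊕-symmetric D-sym P-sym) (⊕-⊆E {H = GX} D⊆GX P⊆GX)
                                 (odd⇒GY ∘ ∈-toSubset⁻ ∘ proj₁ shrinks ∘ ∈-toSubset⁺)
                                 (ℕ.≤-pred (ℕ.≤-trans (p⊂q⇒∣p∣<∣q∣ shrinks) size))
    ... | J , J-shared , odd-J = J ⊕ P , ⊕-shared {GX = GX} {GY} J-shared P-shared , odd-J⊕P
      where
      odd-J⊕P : ∀ v → odd (J ⊕ P) v ≡ odd D v
      odd-J⊕P v = begin
        odd (J ⊕ P) v                      ≡⟨ odd-⊕ J P v ⟩
        odd J v xor odd P v                ≡⟨ cong (_xor odd P v) (trans (odd-J v) (odd-⊕ D P v)) ⟩
        (odd D v xor odd P v) xor odd P v  ≡⟨ xor-assoc (odd D v) _ _ ⟩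
        odd D v xor (odd P v xor odd P v)  ≡⟨ cong (odd D v xor_) (xor-same (odd P v)) ⟩
        odd D v xor false                  ≡⟨ xor-identityʳ (odd D v) ⟩
        odd D v                            ∎
        where open ≡-Reasoning

  cycle-split : {G : Graph n} → IsUnion G GX GY → ∀ {C} → IsCycle G C →
                ∃₂ λ CX CY → IsCycle GX CX × IsCycle GY CY × C ≈E (CX ⊕ CY)
  cycle-split {G} union {C} C-cycle@(C-sym , C⊆G , _) =
    split (shared-join n D-sym D⊆GX (odd⇒vertex {H = GY} R⊆GY ∘ trans (sym (odd-D≡odd-R _)))
                       (∣p∣≤n (toSubset (odd D))))
    where
    D R : EdgeSet n
    D u v = C u v ∧ E GX u v
    R u v = C u v ∧ not (E GX u v)
    D-sym : Symmetric D
    D-sym u v = cong₂ _∧_ (C-sym u v) (Graph.sym GX u v)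
    R-sym : Symmetric R
    R-sym u v = cong₂ _∧_ (C-sym u v) (cong not (Graph.sym GX u v))
    D⊆GX : D ⊆E GX
    D⊆GX u v = Bool.∧-conicalʳ (C u v) _
    R⊆GY : R ⊆E GY
    R⊆GY u v uv with E GX u v | proj₂ union u v
    ... | true  | _      = ⊥-elim (Bool.not-¬ (∧-zeroʳ (C u v)) uv)
    ... | false | E≡E-GY = trans (sym E≡E-GY) (C⊆G u v (Bool.∧-conicalˡ (C u v) _ uv))
    C≈D⊕R : C ≈E (D ⊕ R)
    C≈D⊕R u v = sym (begin
      D u v xor R u v                        ≡⟨ Bool.∧-distribˡ-xor (C u v) (E GX u v) _ ⟨
      C u v ∧ (E GX u v xor not (E GX u v))  ≡⟨ cong (C u v ∧_) (Bool.xor-inverseʳ (E GX u v)) ⟩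
      C u v ∧ true                           ≡⟨ ∧-identityʳ (C u v) ⟩
      C u v                                  ∎)
      where open ≡-Reasoning
    odd-D≡odd-R : ∀ v → odd D v ≡ odd R v
    odd-D≡odd-R v =
      xor≡false⇒≡ (trans (sym (trans (sum-cong-≗ (C≈D⊕R v)) (odd-⊕ D R v))) (cycle⇒even {H = G} C-cycle v))
    cancel : ∀ {x y z} → x ≡ y xor z → z ≡ y → x ≡ false
    cancel {y = y} x≡ refl = trans x≡ (xor-same y)
    split : ∃ (λ J → Shared GX GY J × (∀ v → odd J v ≡ odd D v)) →
            ∃₂ λ CX CY → IsCycle GX CX × IsCycle GY CY × C ≈E (CX ⊕ CY)
    split (J , (J-sym , J⊆GX , J⊆GY) , odd-J) =
      D ⊕ J , R ⊕ J ,
      even⇒cycle {H = GX} (⊕-symmetric D-sym J-sym) (⊕-⊆E {H = GX} D⊆GX J⊆GX)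
                 (λ v → cancel (odd-⊕ D J v) (odd-J v)) ,
      even⇒cycle {H = GY} (⊕-symmetric R-sym J-sym) (⊕-⊆E {H = GY} R⊆GY J⊆GY)
                 (λ v → cancel (odd-⊕ R J v) (trans (odd-J v) (odd-D≡odd-R v))) ,
      λ u v → trans (C≈D⊕R u v) (sym (xor-cancel-common (D u v) (R u v) (J u v)))

  union-generates : {G : Graph n} → IsUnion G GX GY → {BX : Family n k} {BY : Family n l} →
                    Generates GX BX → Generates GY BY → Generates G (BX ∪F BY)
  union-generates {G = G} union {BX} {BY} BX-generates BY-generates C C-cycle
    with cycle-split {G = G} union C-cycle
  ... | CX , CY , CX-cycle , CY-cycle , C≈ with BX-generates CX CX-cycle | BY-generates CY CY-cycle
  ...   | SX , CX≈ | SY , CY≈ = SX ++ SY , λ u v →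
    trans (C≈ u v) (trans (cong₂ _xor_ (CX≈ u v) (CY≈ u v)) (sym (subsetSum-++ SX SY BX BY u v)))

lemma2p8 : ∀ {n} (G GX GY : Graph n) → GX ⊆G G → GY ⊆G G → IsUnion G GX GY
    → (∀ U → IsComponent GX U → Connected (InducedCap GX U GY))
    → (∀ {kX kY} (BX : Family n kX) (BY : Family n kY)
         → IsCycleBasis GX BX → IsCycleBasis GY BY → Generates G (BX ∪F BY))
    × (∀ bG bX bY → IsBn G bG → IsBn GX bX → IsBn GY bY → bG ≤ bX + bY)
lemma2p8 G GX GY GX⊆G GY⊆G union components-meet = generates , bn-subadditive
  where
  generates : ∀ {kX kY} (BX : Family _ kX) (BY : Family _ kY)
              → IsCycleBasis GX BX → IsCycleBasis GY BY → Generates G (BX ∪F BY)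
  generates BX BY (_ , _ , BX-generates) (_ , _ , BY-generates) =
    union-generates components-meet {G = G} union BX-generates BY-generates
  bn-subadditive : ∀ bG bX bY → IsBn G bG → IsBn GX bX → IsBn GY bY → bG ≤ bX + bY
  bn-subadditive bG _ _ (_ , bG-minimal) ((_ , BX , BX-basis , refl) , _) ((_ , BY , BY-basis , refl) , _) =
    let m , R , R-basis , R≤ = cycle-basis-within {H = G} (BX ∪F BY)
                                 (∪F-cycles {G = G} {GX} {GY} GX⊆G GY⊆G (proj₁ BX-basis) (proj₁ BY-basis))
                                 (generates BX BY BX-basis BY-basis)
    in ℕ.≤-trans (bG-minimal m R R-basis) (ℕ.≤-trans R≤ (congestion-∪F BX BY))
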